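{- Let $n\ge 5$ with $n\equiv 0$ or $5\pmod 6$, and let $k=\lfloor (n+2)/6\rfloor$. Then the complement $\overline{G_{n,k}}$ is a base graph.
   Context: For positive integers $n,k$, $G_{n,k}$ is the graph with vertex set $\{0,1,\dots,n-1\}$ in which distinct vertices $i,j$ are adjacent iff $i-j \bmod n$ lies in $\{\pm k,\pm(k+1),\dots,\pm(2k-1)\}\bmod n$. For a vertex $v$, $N_1[v]$ is its closed neighborhood; $u,v$ are true twins if $N_1[u]=N_1[v]$. A base graph is a graph in which no two distinct vertices are true twins. -}

module Defs where

open import Data.Nat using (ℕ; zero; suc; _+_; _*_; _∸_; _≤_; _<_; NonZero)
open import Data.Nat.DivMod using (_%_; _/_)
open import Data.Fin using (Fin; toℕ)
open import Data.Product using (Σ; _×_; _,_)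
open import Data.Sum using (_⊎_)
open import Relation.Nullary using (¬_)
open import Relation.Binary.PropositionalEquality using (_≡_)
open import Function.Bundles using (_⇔_)

Graph : ℕ → Set₁
Graph n = Fin n → Fin n → Set

-- The circulant-type graph G_{n,k}: distinct i, j adjacent iff
-- (i - j) mod n ∈ {±k, ..., ±(2k-1)} mod n, i.e. there is d with
-- k ≤ d ≤ 2k-1 and (i - j ≡ d or i - j ≡ -d (mod n)).
-- (i - j) mod n is computed as (i + n - j) % n, and -d mod n as (j - i) mod n ≡ d mod n.
G : (n k : ℕ) → .{{NonZero n}} → Graph n
G n k i j =
  ¬ (i ≡ j) ×
  Σ ℕ (λ d → (k ≤ d) × (d < 2 * k) ×
     (((toℕ i + n ∸ toℕ j) % n ≡ d % n) ⊎ ((toℕ j + n ∸ toℕ i) % n ≡ d % n)))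

complement : {n : ℕ} → Graph n → Graph n
complement E i j = ¬ (i ≡ j) × ¬ E i j

inN1 : {n : ℕ} → Graph n → Fin n → Fin n → Set
inN1 E v u = (u ≡ v) ⊎ E v u

TrueTwins : {n : ℕ} → Graph n → Fin n → Fin n → Set
TrueTwins {n} E u v = (w : Fin n) → inN1 E u w ⇔ inN1 E v w

IsBaseGraph : {n : ℕ} → Graph n → Set
IsBaseGraph {n} E = (u v : Fin n) → ¬ (u ≡ v) → ¬ TrueTwins E u v

{-# OPTIONS --safe #-}
-- The complement H of G_{n,k} is circulant, so it suffices to separate u from v = u + t with
-- 1 ≤ t ≤ n/2 (otherwise swap u and v), by a vertex w that is G-adjacent to u (so w ∉ N_H[u])
-- but not to v (so w ∈ N_H[v]). For t < 2k take w = u + k: the two residues of v − w are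
-- |t − k| < k and n − |t − k| ≥ 2k. For t ≥ 2k take w = u − k: they are t + k and n − k − t,
-- both at least 2k once t + 3k ≤ n. Both cases only need n ≥ 6k − 1, which holds for
-- k = ⌊(n+2)/6⌋ as long as n ≢ 4 (mod 6).
module Submission where

open import Defs
open import Data.Nat using (ℕ; suc; _+_; _*_; _∸_; _≤_; _<_; _≤?_; _<?_; _≟_; NonZero; >-nonZero⁻¹; z≤n; s≤s)
open import Data.Nat.Properties
open import Data.Nat.DivMod
open import Data.Fin using (Fin; toℕ; fromℕ<) renaming (_≟_ to _≟ᶠ_)
open import Data.Fin.Properties using (toℕ<n; toℕ-fromℕ<; toℕ-injective)
open import Data.Product using (∃-syntax; _×_; _,_; proj₁)
open import Data.Sum as Sum using (_⊎_; inj₁; inj₂; [_,_]; swap)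
open import Function using (_∘_; id)
open import Function.Bundles using (Equivalence)
import Function.Properties.Equivalence as ⇔
open import Relation.Nullary using (¬_; yes; no)
open import Relation.Binary.PropositionalEquality using (_≡_; refl; sym; trans; cong; cong₂; subst; module ≡-Reasoning)

[2*n]∸n≡n : ∀ n → 2 * n ∸ n ≡ n
[2*n]∸n≡n n = trans (m+n∸m≡n n (1 * n)) (*-identityˡ n)

n<2m⇒2[n∸m]≤n : ∀ {m n} → n < 2 * m → 2 * (n ∸ m) ≤ n
n<2m⇒2[n∸m]≤n {m} {n} n<2m = begin
  2 * (n ∸ m)    ≡⟨ *-distribˡ-∸ 2 n m ⟩
  2 * n ∸ 2 * m  ≤⟨ ∸-monoʳ-≤ (2 * n) (<⇒≤ n<2m) ⟩
  2 * n ∸ n      ≡⟨ [2*n]∸n≡n n ⟩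
  n              ∎
  where open ≤-Reasoning

2m≤n+[1+n]⇒m≤n : ∀ {m n} → 2 * m ≤ n + suc n → m ≤ n
2m≤n+[1+n]⇒m≤n {m} {n} le = ≤-pred (*-cancelˡ-< 2 m (suc n) (begin-strict
  2 * m            ≤⟨ le ⟩
  n + suc n        <⟨ +-monoˡ-< (suc n) (n<1+n n) ⟩
  suc n + suc n    ≡⟨ cong (suc n +_) (+-identityʳ (suc n)) ⟨
  2 * suc n        ∎))
  where open ≤-Reasoning

Band : ℕ → ℕ → Set
Band k d = k ≤ d × d < 2 * k

k<2k : ∀ {k} → 1 ≤ k → k < 2 * k
k<2k {k} 1≤k = m<m+n k (≤-trans 1≤k (m≤m+n k 0))

Band-refl : ∀ {k} → 1 ≤ k → Band k k
Band-refl 1≤k = ≤-refl , k<2k 1≤k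

¬Band-< : ∀ {k d} → d < k → ¬ Band k d
¬Band-< d<k (k≤d , _) = <⇒≱ d<k k≤d

¬Band-≥ : ∀ {k d} → 2 * k ≤ d → ¬ Band k d
¬Band-≥ 2k≤d (_ , d<2k) = <⇒≱ d<2k 2k≤d

¬Band-0 : ∀ {k} → ¬ Band k 0
¬Band-0 (z≤n , ())

TrueTwins-sym : ∀ {n} {E : Graph n} {u v} → TrueTwins E u v → TrueTwins E v u
TrueTwins-sym twins w = ⇔.sym (twins w)

¬TrueTwins-complement : ∀ {n} {E : Graph n} {u v w} →
  E u w → ¬ u ≡ w → ¬ E v w → ¬ TrueTwins (complement E) u v
¬TrueTwins-complement {E = E} {u} {v} {w} Euw u≢w ¬Evw twins =
  w∉N[u] (Equivalence.from (twins w) w∈N[v])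
  where
  w∈N[v] : inN1 (complement E) v w
  w∈N[v] with w ≟ᶠ v
  ... | yes w≡v = inj₁ w≡v
  ... | no w≢v = inj₂ (w≢v ∘ sym , ¬Evw)
  w∉N[u] : ¬ inN1 (complement E) u w
  w∉N[u] (inj₁ w≡u) = u≢w (sym w≡u)
  w∉N[u] (inj₂ (_ , ¬Euw)) = ¬Euw Euw

module Residue (n : ℕ) .{{_ : NonZero n}} where

  -- For b ≤ n this is the residue of a − b, written exactly as in the definition of G.
  diff : ℕ → ℕ → ℕ
  diff a b = (a + n ∸ b) % n

  diff<n : ∀ a b → diff a b < n
  diff<n a b = m%n<n (a + n ∸ b) n

  %-cong-+ : ∀ {a a′ b b′} → a % n ≡ a′ % n → b % n ≡ b′ % n → (a + b) % n ≡ (a′ + b′) % n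
  %-cong-+ {a} {a′} {b} {b′} a≡a′ b≡b′ = begin
    (a + b) % n              ≡⟨ %-distribˡ-+ a b n ⟩
    (a % n + b % n) % n      ≡⟨ cong₂ (λ x y → (x + y) % n) a≡a′ b≡b′ ⟩
    (a′ % n + b′ % n) % n    ≡⟨ %-distribˡ-+ a′ b′ n ⟨
    (a′ + b′) % n            ∎
    where open ≡-Reasoning

  +-diff : ∀ a {b} → b ≤ n → (b + diff a b) % n ≡ a % n
  +-diff a {b} b≤n = begin
    (b + diff a b) % n       ≡⟨ %-cong-+ refl (m%n%n≡m%n (a + n ∸ b) n) ⟩
    (b + (a + n ∸ b)) % n    ≡⟨ cong (_% n) (m+[n∸m]≡n (≤-trans b≤n (m≤n+m n a))) ⟩
    (a + n) % n              ≡⟨ [m+n]%n≡m%n a n ⟩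
    a % n                    ∎
    where open ≡-Reasoning

  diff-unique : ∀ {a b r} → b < n → r < n → (b + r) % n ≡ a % n → diff a b ≡ r
  diff-unique {a} {b} {r} b<n r<n b+r≡a = begin
    (a + n ∸ b) % n          ≡⟨ cong (_% n) (+-∸-assoc a (<⇒≤ b<n)) ⟩
    (a + (n ∸ b)) % n        ≡⟨ %-cong-+ (sym b+r≡a) refl ⟩
    (b + r + (n ∸ b)) % n    ≡⟨ cong (λ m → (m + (n ∸ b)) % n) (+-comm b r) ⟩
    (r + b + (n ∸ b)) % n    ≡⟨ cong (_% n) (+-assoc r b (n ∸ b)) ⟩
    (r + (b + (n ∸ b))) % n  ≡⟨ cong (λ m → (r + m) % n) (m+[n∸m]≡n (<⇒≤ b<n)) ⟩
    (r + n) % n              ≡⟨ [m+n]%n≡m%n r n ⟩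
    r % n                    ≡⟨ m<n⇒m%n≡m r<n ⟩
    r                        ∎
    where open ≡-Reasoning

  diff-self : ∀ a → diff a a ≡ 0
  diff-self a = trans (cong (_% n) (m+n∸m≡n a n)) (n%n≡0 n)

  diff-≤ : ∀ {a b} → b ≤ a → a < n → diff a b ≡ a ∸ b
  diff-≤ {a} {b} b≤a a<n =
    diff-unique (≤-<-trans b≤a a<n) (≤-<-trans (m∸n≤m a b) a<n) (cong (_% n) (m+[n∸m]≡n b≤a))

  diff-wrap : ∀ {a b r} → b < n → r < n → b + r ≡ a + n → diff a b ≡ r
  diff-wrap {a} b<n r<n b+r≡a+n =
    diff-unique b<n r<n (trans (cong (_% n) b+r≡a+n) ([m+n]%n≡m%n a n))

  diff-pos : ∀ {a b} → a < n → b < n → ¬ b ≡ a → 0 < diff a b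
  diff-pos {a} {b} a<n b<n b≢a = n≢0⇒n>0 (b≢a ∘ diff≡0⇒b≡a)
    where
    open ≡-Reasoning
    diff≡0⇒b≡a : diff a b ≡ 0 → b ≡ a
    diff≡0⇒b≡a diff≡0 = begin
      b                   ≡⟨ m<n⇒m%n≡m b<n ⟨
      b % n               ≡⟨ cong (_% n) (+-identityʳ b) ⟨
      (b + 0) % n         ≡⟨ cong (λ d → (b + d) % n) diff≡0 ⟨
      (b + diff a b) % n  ≡⟨ +-diff a (<⇒≤ b<n) ⟩
      a % n               ≡⟨ m<n⇒m%n≡m a<n ⟩
      a                   ∎

  diff-flip : ∀ {a b} → a < n → b < n → ¬ b ≡ a → diff b a ≡ n ∸ diff a b
  diff-flip {a} {b} a<n b<n b≢a = diff-unique a<n n∸r<n (begin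
    (a + (n ∸ r)) % n        ≡⟨ %-cong-+ (sym (+-diff a (<⇒≤ b<n))) refl ⟩
    (b + r + (n ∸ r)) % n    ≡⟨ cong (_% n) (+-assoc b r (n ∸ r)) ⟩
    (b + (r + (n ∸ r))) % n  ≡⟨ cong (λ m → (b + m) % n) (m+[n∸m]≡n (<⇒≤ (diff<n a b))) ⟩
    (b + n) % n              ≡⟨ [m+n]%n≡m%n b n ⟩
    b % n                    ∎)
    where
    open ≡-Reasoning
    r = diff a b
    n∸r<n : n ∸ r < n
    n∸r<n = ∸-monoʳ-< (diff-pos a<n b<n b≢a) (<⇒≤ (diff<n a b))

  diff-translate : ∀ c {a b} → b < n → diff ((c + a) % n) ((c + b) % n) ≡ diff a b
  diff-translate c {a} {b} b<n = diff-unique (m%n<n (c + b) n) (diff<n a b) (begin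
    ((c + b) % n + diff a b) % n  ≡⟨ %-cong-+ (m%n%n≡m%n (c + b) n) refl ⟩
    (c + b + diff a b) % n        ≡⟨ cong (_% n) (+-assoc c b (diff a b)) ⟩
    (c + (b + diff a b)) % n      ≡⟨ %-cong-+ refl (+-diff a (<⇒≤ b<n)) ⟩
    (c + a) % n                   ≡⟨ m%n%n≡m%n (c + a) n ⟨
    (c + a) % n % n               ∎)
    where open ≡-Reasoning

  Adjacent : ℕ → ℕ → ℕ → Set
  Adjacent k a b = Band k (diff a b) ⊎ Band k (diff b a)

  Adjacent-sym : ∀ {k a b} → Adjacent k a b → Adjacent k b a
  Adjacent-sym = swap

  Adjacent-irrefl : ∀ {k} a → ¬ Adjacent k a a
  Adjacent-irrefl {k} a = [ ¬Band-at-0 , ¬Band-at-0 ]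
    where
    ¬Band-at-0 : ¬ Band k (diff a a)
    ¬Band-at-0 = ¬Band-0 ∘ subst (Band k) (diff-self a)

  Adjacent-translate : ∀ k c {a b i j} → i ≡ (c + a) % n → j ≡ (c + b) % n → a < n → b < n →
    Adjacent k i j ≡ Adjacent k a b
  Adjacent-translate k c refl refl a<n b<n =
    cong₂ (λ d e → Band k d ⊎ Band k e) (diff-translate c b<n) (diff-translate c a<n)

  G-intro : ∀ {k} {i j : Fin n} → Adjacent k (toℕ i) (toℕ j) → G n k i j
  G-intro {i = i} {j} adj@(inj₁ (k≤d , d<2k)) =
    (λ { refl → Adjacent-irrefl (toℕ i) adj }) , _ , k≤d , d<2k , inj₁ (sym (m%n%n≡m%n (toℕ i + n ∸ toℕ j) n))
  G-intro {i = i} {j} adj@(inj₂ (k≤d , d<2k)) =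
    (λ { refl → Adjacent-irrefl (toℕ i) adj }) , _ , k≤d , d<2k , inj₂ (sym (m%n%n≡m%n (toℕ j + n ∸ toℕ i) n))

  G-elim : ∀ {k} {i j : Fin n} → 2 * k ≤ n → G n k i j → Adjacent k (toℕ i) (toℕ j)
  G-elim {k} 2k≤n (_ , d , k≤d , d<2k , residue≡d) = Sum.map Band-at Band-at residue≡d
    where
    Band-at : ∀ {e} → e ≡ d % n → Band k e
    Band-at e≡d = subst (Band k) (sym (trans e≡d (m<n⇒m%n≡m (<-≤-trans d<2k 2k≤n)))) (k≤d , d<2k)

module _ (n k : ℕ) .{{_ : NonZero n}} (1≤k : 1 ≤ k) (6k≤1+n : 6 * k ≤ suc n) where
  open Residue n

  3k≤1+n : 3 * k ≤ suc n
  3k≤1+n = ≤-trans (*-monoˡ-≤ k (m≤m+n 3 3)) 6k≤1+n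

  2k≤n∸r : ∀ {r} → r < k → 2 * k ≤ n ∸ r
  2k≤n∸r {r} r<k = m+n≤o⇒m≤o∸n (2 * k) (≤-pred (begin-strict
    2 * k + r  <⟨ +-monoʳ-< (2 * k) r<k ⟩
    2 * k + k  ≡⟨ +-comm (2 * k) k ⟩
    3 * k      ≤⟨ 3k≤1+n ⟩
    suc n      ∎))
    where open ≤-Reasoning

  2k≤n : 2 * k ≤ n
  2k≤n = 2k≤n∸r 1≤k

  k<n : k < n
  k<n = <-≤-trans (k<2k 1≤k) 2k≤n

  close⇒¬Adjacent : ∀ {a b} → a < n → b < n → diff a b < k → ¬ Adjacent k a b
  close⇒¬Adjacent {a} {b} a<n b<n r<k with b ≟ a
  ... | yes refl = Adjacent-irrefl a
  ... | no b≢a = [ ¬Band-< r<k , ¬Band-≥ (subst (2 * k ≤_) (sym (diff-flip a<n b<n b≢a)) (2k≤n∸r r<k)) ]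

  n∸k<n : n ∸ k < n
  n∸k<n = ∸-monoʳ-< 1≤k (<⇒≤ k<n)

  0~k : Adjacent k 0 k
  0~k = inj₂ (subst (Band k) (sym (diff-≤ z≤n k<n)) (Band-refl 1≤k))

  0~n∸k : Adjacent k 0 (n ∸ k)
  0~n∸k = inj₁ (subst (Band k) (sym (diff-wrap n∸k<n k<n (m∸n+n≡m (<⇒≤ k<n)))) (Band-refl 1≤k))

  near-offset : ∀ {t} → 1 ≤ t → t < 2 * k → t < n → ¬ Adjacent k t k
  near-offset {t} 1≤t t<2k t<n with ≤-total t k
  ... | inj₁ t≤k = close⇒¬Adjacent k<n t<n (subst (_< k) (sym (diff-≤ t≤k k<n)) (∸-monoʳ-< 1≤t t≤k)) ∘ Adjacent-sym {a = t}
  ... | inj₂ k≤t = close⇒¬Adjacent t<n k<n (subst (_< k) (sym (diff-≤ k≤t t<n)) t∸k<k)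
    where
    t∸k<k : t ∸ k < k
    t∸k<k = subst (t ∸ k <_) ([2*n]∸n≡n k) (∸-monoˡ-< t<2k k≤t)

  far-offset : ∀ {t} → 2 * k ≤ t → 2 * t ≤ n → ¬ Adjacent k t (n ∸ k)
  far-offset {t} 2k≤t 2t≤n = [ ¬Band-≥ 2k≤diff[t,n∸k] , ¬Band-≥ 2k≤diff[n∸k,t] ]
    where
    open ≤-Reasoning
    t+3k≤n : t + 3 * k ≤ n
    t+3k≤n = 2m≤n+[1+n]⇒m≤n (begin
      2 * (t + 3 * k)      ≡⟨ *-distribˡ-+ 2 t (3 * k) ⟩
      2 * t + 2 * (3 * k)  ≡⟨ cong (2 * t +_) (*-assoc 2 3 k) ⟨
      2 * t + 6 * k        ≤⟨ +-mono-≤ 2t≤n 6k≤1+n ⟩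
      n + suc n            ∎)
    t+k<n : t + k < n
    t+k<n = <-≤-trans (+-monoʳ-< t (m<m+n k (≤-trans 1≤k (<⇒≤ (k<2k 1≤k))))) t+3k≤n
    2k≤diff[t,n∸k] : 2 * k ≤ diff t (n ∸ k)
    2k≤diff[t,n∸k] = begin
      2 * k              ≤⟨ ≤-trans 2k≤t (m≤m+n t k) ⟩
      t + k              ≡⟨ diff-wrap n∸k<n t+k<n (begin-equality
        n ∸ k + (t + k)    ≡⟨ +-comm (n ∸ k) (t + k) ⟩
        t + k + (n ∸ k)    ≡⟨ +-assoc t k (n ∸ k) ⟩
        t + (k + (n ∸ k))  ≡⟨ cong (t +_) (m+[n∸m]≡n (<⇒≤ k<n)) ⟩
        t + n              ∎) ⟨
      diff t (n ∸ k)     ∎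
    2k≤diff[n∸k,t] : 2 * k ≤ diff (n ∸ k) t
    2k≤diff[n∸k,t] = begin
      2 * k              ≤⟨ m+n≤o⇒m≤o∸n (2 * k) (m+n≤o⇒m≤o∸n (2 * k + t) (begin
        2 * k + t + k      ≡⟨ +-comm (2 * k + t) k ⟩
        k + (2 * k + t)    ≡⟨ +-assoc k (2 * k) t ⟨
        3 * k + t          ≡⟨ +-comm (3 * k) t ⟩
        t + 3 * k          ≤⟨ t+3k≤n ⟩
        n                  ∎)) ⟩
      n ∸ k ∸ t          ≡⟨ diff-≤ (m+n≤o⇒m≤o∸n t (<⇒≤ t+k<n)) n∸k<n ⟨
      diff (n ∸ k) t     ∎

  separating-offset : ∀ {t} → 1 ≤ t → 2 * t ≤ n → ∃[ x ] x < n × Adjacent k 0 x × ¬ Adjacent k t x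
  separating-offset {t} 1≤t 2t≤n with t <? 2 * k
  ... | yes t<2k = k , k<n , 0~k , near-offset 1≤t t<2k (<-≤-trans (k<2k 1≤t) 2t≤n)
  ... | no t≮2k = n ∸ k , n∸k<n , 0~n∸k , far-offset (≮⇒≥ t≮2k) 2t≤n

  no-twins-at-offset : (u v : Fin n) → 1 ≤ diff (toℕ v) (toℕ u) → 2 * diff (toℕ v) (toℕ u) ≤ n →
    ¬ TrueTwins (complement (G n k)) u v
  no-twins-at-offset u v 1≤t 2t≤n with separating-offset 1≤t 2t≤n
  ... | x , x<n , 0~x , t≁x = ¬TrueTwins-complement Guw (proj₁ Guw) (t≁x ∘ subst id v~w ∘ G-elim 2k≤n)
    where
    w : Fin n
    w = fromℕ< (m%n<n (toℕ u + x) n)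
    u~w : Adjacent k (toℕ u) (toℕ w) ≡ Adjacent k 0 x
    u~w = Adjacent-translate k (toℕ u)
      (sym (trans (cong (_% n) (+-identityʳ (toℕ u))) (m<n⇒m%n≡m (toℕ<n u))))
      (toℕ-fromℕ< _) (>-nonZero⁻¹ n) x<n
    v~w : Adjacent k (toℕ v) (toℕ w) ≡ Adjacent k (diff (toℕ v) (toℕ u)) x
    v~w = Adjacent-translate k (toℕ u)
      (sym (trans (+-diff (toℕ v) (<⇒≤ (toℕ<n u))) (m<n⇒m%n≡m (toℕ<n v))))
      (toℕ-fromℕ< _) (diff<n (toℕ v) (toℕ u)) x<n
    Guw : G n k u w
    Guw = G-intro (subst id (sym u~w) 0~x)

  complement-G-isBase : IsBaseGraph (complement (G n k))
  complement-G-isBase u v u≢v twins with 2 * diff (toℕ v) (toℕ u) ≤? n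
  ... | yes 2t≤n = no-twins-at-offset u v (diff-pos (toℕ<n v) (toℕ<n u) (u≢v ∘ toℕ-injective)) 2t≤n twins
  ... | no 2t≰n = no-twins-at-offset v u (diff-pos (toℕ<n u) (toℕ<n v) (u≢v ∘ sym ∘ toℕ-injective)) 2t′≤n
                    (TrueTwins-sym twins)
    where
    2t′≤n : 2 * diff (toℕ u) (toℕ v) ≤ n
    2t′≤n = subst (λ s → 2 * s ≤ n) (sym (diff-flip (toℕ<n v) (toℕ<n u) (u≢v ∘ toℕ-injective)))
              (n<2m⇒2[n∸m]≤n {diff (toℕ v) (toℕ u)} (≰⇒> 2t≰n))

1≤[n+2]/6 : ∀ {n} → 5 ≤ n → 1 ≤ (n + 2) / 6
1≤[n+2]/6 5≤n = m≥n⇒m/n>0 (≤-trans (n≤1+n 6) (+-monoˡ-≤ 2 5≤n))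

6*[[n+2]/6]≤1+n : ∀ n → n % 6 ≡ 0 ⊎ n % 6 ≡ 5 → 6 * ((n + 2) / 6) ≤ suc n
6*[[n+2]/6]≤1+n n n%6 = ≤-pred (begin
  suc (6 * q)          ≡⟨ cong suc (*-comm 6 q) ⟩
  1 + q * 6            ≤⟨ +-monoˡ-≤ (q * 6) 1≤[n+2]%6 ⟩
  (n + 2) % 6 + q * 6  ≡⟨ m≡m%n+[m/n]*n (n + 2) 6 ⟨
  n + 2                ≡⟨ +-comm n 2 ⟩
  suc (suc n)          ∎)
  where
  open ≤-Reasoning
  q = (n + 2) / 6
  1≤[n+2]%6 : 1 ≤ (n + 2) % 6
  1≤[n+2]%6 = subst (1 ≤_) (sym (%-distribˡ-+ n 2 6)) (1≤[r+2]%6 n%6)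
    where
    1≤[r+2]%6 : ∀ {r} → r ≡ 0 ⊎ r ≡ 5 → 1 ≤ (r + 2 % 6) % 6
    1≤[r+2]%6 (inj₁ refl) = s≤s z≤n
    1≤[r+2]%6 (inj₂ refl) = s≤s z≤n

mainTheorem9 : (n : ℕ) → .{{_ : NonZero n}} → 5 ≤ n → (n % 6 ≡ 0 ⊎ n % 6 ≡ 5) →
    IsBaseGraph (complement (G n ((n + 2) / 6)))
mainTheorem9 n 5≤n n%6 = complement-G-isBase n ((n + 2) / 6) (1≤[n+2]/6 5≤n) (6*[[n+2]/6]≤1+n n n%6)
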